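{- Let $n=2^r$ for some $r\in\mathbb{N}$, and let $K_{n,n}$ be the complete bipartite graph with $n$ vertices on each side. Then $\mathrm{AC}(K_{n,n})=\log_2(n)$.
   Context: Acquaintance time: for a connected graph, place one agent on each vertex. Two agents are acquainted once they occupy the two endpoints of a common edge at some time (including the initial placement). In each round one chooses a matching (set of pairwise vertex-disjoint edges, not necessarily maximal), and for every edge of it the two agents on its endpoints swap places. A strategy for acquaintance is a sequence of matchings after which every pair of agents has been acquainted; $\mathrm{AC}(G)$ is the minimum number of rounds in such a strategy. -}

module Defs where

open import Data.Nat using (ℕ; _<_; _≤_; _+_)
open import Data.Fin using (Fin; toℕ)
open import Data.List using (List; []; _∷_; length)
open import Data.List.Membership.Propositional using (_∈_)
open import Data.Product using (Σ; ∃; _×_; _,_)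
open import Data.Sum using (_⊎_)
open import Function using (id)
open import Relation.Binary.PropositionalEquality using (_≡_; _≢_)

Graph : ℕ → Set₁
Graph m = Fin m → Fin m → Set

K : (n : ℕ) → Graph (n + n)
K n u v = (toℕ u < n × n ≤ toℕ v) ⊎ (n ≤ toℕ u × toℕ v < n)

-- A matching (set of pairwise vertex-disjoint edges), encoded by the
-- partner map: an involution whose non-fixed points are joined by an edge.
-- Unmatched vertices are fixed points.
record Matching {m : ℕ} (E : Graph m) : Set where
  field
    partner : Fin m → Fin m
    involutive : ∀ v → partner (partner v) ≡ v
    isEdge : ∀ v → partner v ≡ v ⊎ E v (partner v)

open Matching public

-- A placement assigns to each vertex the agent (named by its initial vertex) on it.
Placement : ℕ → Set
Placement m = Fin m → Fin m

step : ∀ {m} {E : Graph m} → Placement m → Matching E → Placement m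
step p μ v = p (partner μ v)

placements : ∀ {m} {E : Graph m} → Placement m → List (Matching E) → List (Placement m)
placements p [] = p ∷ []
placements p (μ ∷ s) = p ∷ placements (step p μ) s

Acquainted : ∀ {m} (E : Graph m) → List (Matching E) → Fin m → Fin m → Set
Acquainted {m} E s a b =
  Σ (Placement m) λ p → p ∈ placements id s ×
    (Σ (Fin m) λ u → Σ (Fin m) λ v → E u v × p u ≡ a × p v ≡ b)

IsStrategy : ∀ {m} (E : Graph m) → List (Matching E) → Set
IsStrategy {m} E s = ∀ (a b : Fin m) → a ≢ b → Acquainted E s a b

ACis : ∀ {m} (E : Graph m) → ℕ → Set
ACis E k =
  (Σ (List (Matching E)) λ s → IsStrategy E s × length s ≡ k) ×
  (∀ (s : List (Matching E)) → IsStrategy E s → k ≤ length s)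

module Submission where

-- Lower bound (for any properly 2-coloured graph).  Follow each agent
-- through a strategy and record the colour of the vertex it occupies at
-- every time: its itinerary.  Two agents on an edge see different colours at
-- that moment, so in a strategy all agents have pairwise distinct
-- itineraries.  Agents starting in one colour class agree on the first entry,
-- leaving 2 ^ (number of rounds) possible itineraries; by pigeonhole a class
-- of N agents forces N ≤ 2 ^ (number of rounds).  A side of K_{n,n} has n
-- agents, so a strategy of k rounds has n ≤ 2 ^ k, i.e. k ≥ log₂ n.
--
-- Upper bound.  View K_{n,n} as n columns, each made of one vertex of each
-- side.  A round that flips some columns (swapping the two agents of each
-- flipped column) keeps every agent in its column; prescribing for each time
-- which columns are flipped relative to the start gives a strategy as soon as
-- any two distinct columns are flipped differently at some time.  With
-- n = 2 ^ r columns, the r binary digits of the column index do this.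

open import Defs
open import Data.Nat using (ℕ; zero; suc; _+_; _^_; _≤_; _<_; z≤n; s≤s; _≤?_)
open import Data.Nat.Logarithm using (⌊log₂_⌋; ⌊log₂[2^n]⌋≡n)
open import Data.Nat.Properties using (<⇒≱; ≰⇒>; ≮⇒≥; m≤m+n; ^-monoʳ-<)
open import Data.Bool using (Bool; true; false; _xor_)
open import Data.Bool.Properties using (not-injective; xor-assoc; xor-same; xor-identityʳ)
  renaming (_≟_ to _≟ᵇ_)
import Data.Fin as Fin
open import Data.Fin using (Fin; toℕ; _↑ˡ_; _↑ʳ_; splitAt; combine; funToFin; finToFun)
open import Data.Fin.Properties
  using (toℕ<n; toℕ-↑ˡ; toℕ-↑ʳ; ↑ˡ-injective; splitAt-↑ˡ; splitAt-↑ʳ; splitAt⁻¹-↑ˡ; splitAt⁻¹-↑ʳ;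
         combine-injective; funToFin-finToFin; ¬∀⟶∃¬; pigeonhole; 2↔Bool)
  renaming (_≟_ to _≟ᶠ_; <⇒≢ to <⇒≢ᶠ)
open import Data.List using (List; []; _∷_; length; map; allFin)
open import Data.List.Properties using (length-map; length-tabulate)
open import Data.List.Membership.Propositional using (_∈_)
open import Data.List.Membership.Propositional.Properties using (∈-map⁺; ∈-allFin)
open import Data.List.Relation.Unary.Any using (here; there)
open import Data.Vec using (Vec; []; _∷_; head; tail)
open import Data.Empty using (⊥; ⊥-elim)
open import Data.Product using (∃; _×_; _,_)
open import Data.Sum using (_⊎_; inj₁; inj₂; [_,_]′)
open import Function using (id; _∘_; const)
open import Function.Bundles using (Injection; Inverse)
open import Function.Properties.Inverse using (↔⇒↣; ↔-sym)
open import Relation.Nullary using (yes; no; does)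
open import Relation.Nullary.Decidable using (dec-true; dec-false)
open import Relation.Binary.PropositionalEquality
  using (_≡_; _≢_; _≗_; refl; sym; trans; cong; cong₂; subst; subst₂; module ≡-Reasoning)

xor-cancelʳ : ∀ c a → (c xor a) xor a ≡ c
xor-cancelʳ c a = trans (xor-assoc c a a) (trans (cong (c xor_) (xor-same a)) (xor-identityʳ c))

xor-injectiveʳ : ∀ c {a b} → c xor a ≡ c xor b → a ≡ b
xor-injectiveʳ false eq = eq
xor-injectiveʳ true eq = not-injective eq

xor-reflip : ∀ c a b → (c xor (a xor b)) xor a ≡ c xor b
xor-reflip false false b = xor-identityʳ b
xor-reflip false true false = refl
xor-reflip false true true = refl
xor-reflip true false b = xor-identityʳ _
xor-reflip true true false = refl
xor-reflip true true true = refl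

start∈placements : ∀ {m} {E : Graph m} (p : Placement m) (s : List (Matching E)) →
                   p ∈ placements p s
start∈placements p [] = here refl
start∈placements p (μ ∷ s) = here refl

encode : ∀ {k} → Vec Bool k → Fin (2 ^ k)
encode [] = Fin.zero
encode (b ∷ bs) = combine (Inverse.from 2↔Bool b) (encode bs)

encode-injective : ∀ {k} (v w : Vec Bool k) → encode v ≡ encode w → v ≡ w
encode-injective [] [] _ = refl
encode-injective (b ∷ v) (c ∷ w) eq with combine-injective _ _ _ _ eq
... | b≡c , v≡w = cong₂ _∷_ (Injection.injective (↔⇒↣ (↔-sym 2↔Bool)) b≡c)
                            (encode-injective v w v≡w)

module ProperColouring {m : ℕ} {E : Graph m} (col : Fin m → Bool)
                       (proper : ∀ {u v} → E u v → col u ≢ col v) where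

  -- With q mapping each agent to its current vertex, the colours seen by
  -- agent a now and after each of the rounds of s.
  itinerary : (q : Fin m → Fin m) (s : List (Matching E)) → Fin m → Vec Bool (suc (length s))
  later : (q : Fin m → Fin m) (s : List (Matching E)) → Fin m → Vec Bool (length s)
  itinerary q s a = col (q a) ∷ later q s a
  later q [] a = []
  later q (μ ∷ s) a = itinerary (partner μ ∘ q) s a

  differ-now : ∀ s (p q : Placement m) → (∀ v → q (p v) ≡ v) →
               ∀ {u v} → E u v → itinerary q s (p u) ≢ itinerary q s (p v)
  differ-now s p q inv {u} {v} e same =
    proper e (subst₂ (λ x y → col x ≡ col y) (inv u) (inv v) (cong head same))

  -- Agents met along an edge at some time have different itineraries; here
  -- p is the current placement and q its inverse.
  acquainted⇒differ : ∀ s (p q : Placement m) → (∀ v → q (p v) ≡ v) →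
                      ∀ {p′ u v} → p′ ∈ placements p s → E u v →
                      itinerary q s (p′ u) ≢ itinerary q s (p′ v)
  acquainted⇒differ [] p q inv (here refl) e = differ-now [] p q inv e
  acquainted⇒differ (μ ∷ s) p q inv (here refl) e = differ-now (μ ∷ s) p q inv e
  acquainted⇒differ (μ ∷ s) p q inv (there mem) e same =
    acquainted⇒differ s (step p μ) (partner μ ∘ q) inv′ mem e (cong tail same)
    where
    inv′ : ∀ v → partner μ (q (p (partner μ v))) ≡ v
    inv′ v = trans (cong (partner μ) (inv (partner μ v))) (involutive μ v)

  strategy⇒distinct-itineraries : ∀ s → IsStrategy E s →
                                  ∀ a b → a ≢ b → itinerary id s a ≢ itinerary id s b
  strategy⇒distinct-itineraries s st a b a≢b with st a b a≢b
  ... | p , mem , u , v , e , refl , refl = acquainted⇒differ s id id (λ _ → refl) mem e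

  -- Agents ι i all start with colour c, so they must be told apart by the last
  -- length s entries of their itineraries: pigeonhole.
  colour-class-bound : ∀ {N c} (ι : Fin N → Fin m) → (∀ i j → ι i ≡ ι j → i ≡ j) →
                       (∀ i → col (ι i) ≡ c) → ∀ s → IsStrategy E s → N ≤ 2 ^ length s
  colour-class-bound {N} ι ι-injective colour s st = ≮⇒≥ too-many
    where
    too-many : 2 ^ length s < N → ⊥
    too-many fewer with pigeonhole fewer (λ i → encode (later id s (ι i)))
    ... | i , j , i<j , same =
      strategy⇒distinct-itineraries s st (ι i) (ι j) (<⇒≢ᶠ i<j ∘ ι-injective i j)
        (cong₂ _∷_ (trans (colour i) (sym (colour j))) (encode-injective _ _ same))

module Columns (n : ℕ) where

  V : Set
  V = Fin (n + n)

  side : V → Bool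
  side v = does (n ≤? toℕ v)

  K-proper : ∀ {u v} → K n u v → side u ≢ side v
  K-proper {u} {v} (inj₁ (u<n , n≤v))
    rewrite dec-false (n ≤? toℕ u) (<⇒≱ u<n) | dec-true (n ≤? toℕ v) n≤v = λ ()
  K-proper {u} {v} (inj₂ (n≤u , v<n))
    rewrite dec-true (n ≤? toℕ u) n≤u | dec-false (n ≤? toℕ v) (<⇒≱ v<n) = λ ()

  K-complete : ∀ {u v} → side u ≢ side v → K n u v
  K-complete {u} {v} ne with n ≤? toℕ u | n ≤? toℕ v
  ... | yes n≤u | no v≱n = inj₂ (n≤u , ≰⇒> v≱n)
  ... | no u≱n | yes n≤v = inj₁ (≰⇒> u≱n , n≤v)
  ... | yes n≤u | yes n≤v = ⊥-elim (ne (trans (dec-true (n ≤? toℕ u) n≤u) (sym (dec-true (n ≤? toℕ v) n≤v))))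
  ... | no u≱n | no v≱n = ⊥-elim (ne (trans (dec-false (n ≤? toℕ u) u≱n) (sym (dec-false (n ≤? toℕ v) v≱n))))

  pos : Bool → Fin n → V
  pos false x = x ↑ˡ n
  pos true x = n ↑ʳ x

  side-pos : ∀ c x → side (pos c x) ≡ c
  side-pos false x = dec-false (n ≤? toℕ (x ↑ˡ n)) (<⇒≱ (subst (_< n) (sym (toℕ-↑ˡ x n)) (toℕ<n x)))
  side-pos true x = dec-true (n ≤? toℕ (n ↑ʳ x)) (subst (n ≤_) (sym (toℕ-↑ʳ n x)) (m≤m+n n (toℕ x)))

  K-pos : ∀ {c d} x y → c ≢ d → K n (pos c x) (pos d y)
  K-pos {c} {d} x y c≢d = K-complete (subst₂ _≢_ (sym (side-pos c x)) (sym (side-pos d y)) c≢d)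

  view : ∀ v → ∃ λ c → ∃ λ x → pos c x ≡ v
  view v with splitAt n v in eq
  ... | inj₁ x = false , x , splitAt⁻¹-↑ˡ eq
  ... | inj₂ x = true , x , splitAt⁻¹-↑ʳ eq

  AC-lower : ∀ s → IsStrategy (K n) s → n ≤ 2 ^ length s
  AC-lower = colour-class-bound (pos false) (↑ˡ-injective n) (side-pos false)
    where open ProperColouring side K-proper

  lift : {A : Set} → (Bool → Fin n → A) → V → A
  lift f v = [ f false , f true ]′ (splitAt n v)

  lift-pos : {A : Set} (f : Bool → Fin n → A) → ∀ c x → lift f (pos c x) ≡ f c x
  lift-pos f false x = cong [ f false , f true ]′ (splitAt-↑ˡ n x n)
  lift-pos f true x = cong [ f false , f true ]′ (splitAt-↑ʳ n n x)

  flip : (Fin n → Bool) → V → V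
  flip f = lift (λ c x → pos (c xor f x) x)

  flip-pos : ∀ f c x → flip f (pos c x) ≡ pos (c xor f x) x
  flip-pos f = lift-pos (λ c x → pos (c xor f x) x)

  flip-involutive : ∀ f v → flip f (flip f v) ≡ v
  flip-involutive f v with view v
  ... | c , x , refl = begin
    flip f (flip f (pos c x))        ≡⟨ cong (flip f) (flip-pos f c x) ⟩
    flip f (pos (c xor f x) x)       ≡⟨ flip-pos f (c xor f x) x ⟩
    pos ((c xor f x) xor f x) x      ≡⟨ cong (λ e → pos e x) (xor-cancelʳ c (f x)) ⟩
    pos c x                          ∎
    where open ≡-Reasoning

  flip-isEdge : ∀ f v → flip f v ≡ v ⊎ K n v (flip f v)
  flip-isEdge f v with view v
  ... | c , x , refl rewrite flip-pos f c x with f x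
  ... | false = inj₁ (cong (λ e → pos e x) (xor-identityʳ c))
  ... | true = inj₂ (K-pos x x (flipped c))
    where
    flipped : ∀ c → c ≢ c xor true
    flipped false ()
    flipped true ()

  columnFlip : (Fin n → Bool) → Matching (K n)
  columnFlip f = record { partner = flip f ; involutive = flip-involutive f ; isEdge = flip-isEdge f }

  Flipped : Placement (n + n) → (Fin n → Bool) → Set
  Flipped p d = ∀ c x → p (pos c x) ≡ pos (c xor d x) x

  flipped-start : Flipped id (const false)
  flipped-start c x = cong (λ e → pos e x) (sym (xor-identityʳ c))

  flipped-step : ∀ {p prev} d → Flipped p prev →
                 Flipped (step p (columnFlip (λ x → prev x xor d x))) d
  flipped-step {p} {prev} d flipped c x = begin
    p (flip g (pos c x))                   ≡⟨ cong p (flip-pos g c x) ⟩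
    p (pos (c xor g x) x)                  ≡⟨ flipped (c xor g x) x ⟩
    pos ((c xor g x) xor prev x) x         ≡⟨ cong (λ e → pos e x) (xor-reflip c (prev x) (d x)) ⟩
    pos (c xor d x) x                      ∎
    where
    open ≡-Reasoning
    g : Fin n → Bool
    g x = prev x xor d x

  schedule : (Fin n → Bool) → List (Fin n → Bool) → List (Matching (K n))
  schedule prev [] = []
  schedule prev (d ∷ ds) = columnFlip (λ x → prev x xor d x) ∷ schedule d ds

  schedule-length : ∀ prev ds → length (schedule prev ds) ≡ length ds
  schedule-length prev [] = refl
  schedule-length prev (d ∷ ds) = cong suc (schedule-length d ds)

  schedule-reaches : ∀ {p prev d ds} → Flipped p prev → d ∈ ds →
                     ∃ λ p′ → p′ ∈ placements p (schedule prev ds) × Flipped p′ d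
  schedule-reaches {p} {prev} {ds = d ∷ ds} flipped (here refl) =
    _ , there (start∈placements _ (schedule d ds)) , flipped-step {p} {prev} d flipped
  schedule-reaches {p} {prev} {ds = d′ ∷ ds} flipped (there d∈ds)
    with schedule-reaches (flipped-step {p} {prev} d′ flipped) d∈ds
  ... | p′ , mem , flipped′ = p′ , there mem , flipped′

  Separating : List (Fin n → Bool) → Set
  Separating ds = ∀ {x y} → x ≢ y → ∃ λ d → d ∈ ds × d x ≢ d y

  -- Same-side agents of distinct columns meet once their columns are flipped
  -- differently; agents on different sides are adjacent from the start.
  schedule-strategy : ∀ {ds} → Separating ds → IsStrategy (K n) (schedule (const false) ds)
  schedule-strategy {ds} separating a b a≢b with view a | view b
  ... | c , x , refl | c′ , y , refl with c ≟ᵇ c′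
  ... | no c≢c′ = id , start∈placements id _ , pos c x , pos c′ y , K-pos x y c≢c′ , refl , refl
  ... | yes refl with separating (λ x≡y → a≢b (cong (pos c) x≡y))
  ... | d , d∈ds , dx≢dy with schedule-reaches flipped-start d∈ds
  ... | p , mem , flipped =
    p , mem , pos (c xor d x) x , pos (c xor d y) y ,
    K-pos x y (dx≢dy ∘ xor-injectiveʳ c) , unflip x , unflip y
    where
    unflip : ∀ z → p (pos (c xor d z) z) ≡ pos c z
    unflip z = trans (flipped (c xor d z) z) (cong (λ e → pos e z) (xor-cancelʳ c (d z)))

-- Binary digits: the r digits of x : Fin (2 ^ r) determine x.  The library
-- proves funToFin ∘ finToFun ≗ id; injectivity also needs funToFin to respect
-- pointwise equality.
funToFin-cong : ∀ {k m} {f g : Fin k → Fin m} → f ≗ g → funToFin f ≡ funToFin g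
funToFin-cong {zero} f≗g = refl
funToFin-cong {suc k} f≗g = cong₂ combine (f≗g Fin.zero) (funToFin-cong (f≗g ∘ Fin.suc))

finToFun-injective : ∀ {m k} {x y : Fin (m ^ k)} → finToFun {m} {k} x ≗ finToFun y → x ≡ y
finToFun-injective {m} {k} {x} {y} same =
  trans (sym (funToFin-finToFin {k} {m} x)) (trans (funToFin-cong same) (funToFin-finToFin {k} {m} y))

digit : ∀ r → Fin r → Fin (2 ^ r) → Bool
digit r i x = Inverse.to 2↔Bool (finToFun {2} {r} x i)

digitFlips : ∀ r → List (Fin (2 ^ r) → Bool)
digitFlips r = map (digit r) (allFin r)

digitFlips-length : ∀ r → length (digitFlips r) ≡ r
digitFlips-length r = trans (length-map (digit r) (allFin r)) (length-tabulate id)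

digitFlips-separating : ∀ r → Columns.Separating (2 ^ r) (digitFlips r)
digitFlips-separating r {x} {y} x≢y
  with ¬∀⟶∃¬ r (λ i → finToFun {2} {r} x i ≡ finToFun y i)
              (λ i → finToFun {2} {r} x i ≟ᶠ finToFun y i) (x≢y ∘ finToFun-injective {2} {r})
... | i , differ = digit r i , ∈-map⁺ (digit r) (∈-allFin i) , differ ∘ Injection.injective (↔⇒↣ 2↔Bool)

2^-reflects-≤ : ∀ r k → 2 ^ r ≤ 2 ^ k → r ≤ k
2^-reflects-≤ r k 2^r≤2^k = ≮⇒≥ (λ k<r → <⇒≱ (^-monoʳ-< 2 (s≤s (s≤s z≤n)) k<r) 2^r≤2^k)

proposition4p3 : ∀ (r : ℕ) → ACis (K (2 ^ r)) ⌊log₂ (2 ^ r) ⌋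
proposition4p3 r rewrite ⌊log₂[2^n]⌋≡n r =
  (schedule (const false) (digitFlips r) ,
   schedule-strategy (digitFlips-separating r) ,
   trans (schedule-length (const false) (digitFlips r)) (digitFlips-length r)) ,
  λ s st → 2^-reflects-≤ r (length s) (AC-lower s st)
  where open Columns (2 ^ r)
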